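{- Let $Q$ be the $3\times 3$ grid on vertices $(i,j)$, $1\le i,j\le 3$ (with $(i,j)\sim(p,q)$ iff $|i-p|+|j-q|=1$), let $A=\{(3,1),(3,2),(3,3)\}$, $B=\{(1,3),(2,3),(3,3)\}$, $c=(1,1)$ and $b=(2,3)$. Let $Q_0$ be the graph obtained from $Q$ by removing the edges $(3,1)(3,2)$ and $(3,2)(3,3)$ of $A$. Let $T$ be a set of at most four distinct vertices of $Q_0$. Say that a vertex $s\in T$ is good if there exist pairwise edge disjoint paths in $Q_0$ consisting of an $s,b$-path together with, for each $t\in T\setminus\{s\}$, a path from $t$ to some vertex of $A$ (these end vertices not necessarily distinct). (i) If $T\cap A=\emptyset$ and $c\notin T$, then every $s\in T$ is good. (ii) If $T\neq T_1$ and $T\neq T_2$, where $T_1=\{(1,1),(2,1),(3,1)\}$ and $T_2=\{(1,1),(1,2),(1,3),(2,3)\}$, then at least $\min\{3,|T|\}$ vertices of $T$ are good. (iii) If $T=T_1$, then the good vertices of $T$ are exactly $(1,1)$ and $(2,1)$; if $T=T_2$, then the good vertices of $T$ are exactly $(2,3)$ and $(1,3)$.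
   Context: A path may be trivial (a single vertex); e.g. if $s=b$ the $s,b$-path is trivial, and a vertex of $T$ lying in $A$ may be taken to itself. -}

module Defs where

open import Data.Nat using (ℕ; ∣_-_∣; _≤_; _⊓_)
open import Data.Fin using (Fin; zero; suc; toℕ)
open import Data.Fin.Properties using () renaming (_≟_ to _≟F_)
open import Data.Product using (Σ; ∃; ∃-syntax; _×_; _,_; swap)
open import Data.Product.Properties using (≡-dec)
open import Data.Sum using (_⊎_)
open import Data.List using (List; []; _∷_; filter; length)
open import Data.List.Membership.Propositional using (_∈_)
open import Data.List.Relation.Unary.Unique.Propositional using (Unique)
open import Data.List.Relation.Unary.AllPairs using (AllPairs)
open import Data.List.Relation.Binary.Pointwise using (Pointwise)
open import Relation.Binary.PropositionalEquality using (_≡_)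
open import Relation.Nullary using (¬_; ¬?)
open import Relation.Nullary.Decidable using (Dec)

-- Vertex (i,j) of the paper (1 ≤ i,j ≤ 3) is represented by (i-1 , j-1) : Fin 3 × Fin 3.
V : Set
V = Fin 3 × Fin 3

_≟V_ : (u v : V) → Dec (u ≡ v)
_≟V_ = ≡-dec _≟F_ _≟F_

f1 f2 f3 : Fin 3
f1 = zero
f2 = suc zero
f3 = suc (suc zero)

v11 v12 v13 v21 v22 v23 v31 v32 v33 : V
v11 = f1 , f1
v12 = f1 , f2
v13 = f1 , f3
v21 = f2 , f1
v22 = f2 , f2
v23 = f2 , f3
v31 = f3 , f1
v32 = f3 , f2
v33 = f3 , f3

Adj : V → V → Set
Adj (i , j) (p , q) = ∣ toℕ i - toℕ p ∣ Data.Nat.+ ∣ toℕ j - toℕ q ∣ ≡ 1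

Removed : V → V → Set
Removed u v = ((u ≡ v31 × v ≡ v32) ⊎ (u ≡ v32 × v ≡ v31))
            ⊎ ((u ≡ v32 × v ≡ v33) ⊎ (u ≡ v33 × v ≡ v32))

Adj₀ : V → V → Set
Adj₀ u v = Adj u v × ¬ Removed u v

A B : List V
A = v31 ∷ v32 ∷ v33 ∷ []
B = v13 ∷ v23 ∷ v33 ∷ []

c b : V
c = v11
b = v23

T₁ T₂ : List V
T₁ = v11 ∷ v21 ∷ v31 ∷ []
T₂ = v11 ∷ v12 ∷ v13 ∷ v23 ∷ []

data Walk : V → V → List V → Set where
  single : ∀ {u} → Walk u u (u ∷ [])
  step   : ∀ {u w v p} → Adj₀ u w → Walk w v p → Walk u v (u ∷ p)

Path : V → V → List V → Set
Path u v p = Walk u v p × Unique p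

edges : List V → List (V × V)
edges []           = []
edges (x ∷ [])     = []
edges (x ∷ y ∷ xs) = (x , y) ∷ edges (y ∷ xs)

SameEdge : V × V → V × V → Set
SameEdge e f = e ≡ f ⊎ e ≡ swap f

EdgeDisjoint : List V → List V → Set
EdgeDisjoint p q = ∀ e f → e ∈ edges p → f ∈ edges q → ¬ SameEdge e f

PathToA : V → List V → Set
PathToA t p = ∃[ a ] (a ∈ A × Path t a p)

_minus_ : List V → V → List V
T minus s = filter (λ t → ¬? (t ≟V s)) T

Good : List V → V → Set
Good T s = s ∈ T × ∃[ P ] (Path s b P × ∃[ Ps ]
             (Pointwise PathToA (T minus s) Ps × AllPairs EdgeDisjoint (P ∷ Ps)))

SameSet : List V → List V → Set
SameSet S T = ∀ v → (v ∈ S → v ∈ T) × (v ∈ T → v ∈ S)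

AtLeastGood : ℕ → List V → Set
AtLeastGood k T = ∃[ S ] (Unique S × (∀ v → v ∈ S → v ∈ T) × (∀ v → v ∈ S → Good T v) × k ≤ length S)

module Submission where

-- Lemma 9 is a statement about one fixed graph Q₀ on nine vertices, so it is proved
-- by a verified exhaustive search.
--
-- Because type-checking does not share computations, the paths from each
--    vertex to A and to b are written out as literal tables; a single decision per
--    table certifies that it lists exactly those paths.
-- 3. With these tables a backtracking search decides whether a terminal s is good.
-- 4. Goodness, and hence each of the assertions (i)-(iii), depends on T only up to
--    permutation; a duplicate-free T is a permutation of its canonical representative,
--    the sublist of the vertex list whose elements lie in T.
-- 5. The assertions, with all quantifiers bounded, are decided for every subset of at
--    most four vertices; Lemma 9 follows by transporting along the permutation.

open import Defs
open import Data.Bool using (true; false)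
open import Data.Fin using (zero; suc; toℕ)
open import Data.Nat using (ℕ; zero; suc; _+_; ∣_-_∣; _≤_; s≤s; _⊓_; _≤?_) renaming (_≟_ to _≟ℕ_)
open import Data.Nat.Properties using (≤-refl; ≤-trans)
open import Data.Product using (∃-syntax; _×_; _,_; proj₁; proj₂; swap)
open import Data.Product.Properties using (≡-dec)
open import Data.Sum using (_⊎_; inj₁; inj₂)
open import Data.List using (List; []; _∷_; length; filter; map; concatMap; _++_)
open import Data.List.Properties using (filter-notAll) renaming (≡-dec to ≡-decᴸ)
open import Data.List.Membership.Propositional using (_∈_; _∉_; find; lose)
open import Data.List.Membership.Propositional.Properties
  using (∈-filter⁺; ∈-filter⁻; ∈-map⁺; ∈-concatMap⁺; ∈-++⁺ˡ; ∈-++⁺ʳ)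
open import Data.List.Membership.Propositional.Properties.WithK using (unique∧set⇒bag)
open import Data.List.Membership.DecPropositional _≟V_ using (_∈?_)
import Data.List.Membership.DecPropositional
open import Data.List.Relation.Unary.All as All using (All; []; _∷_)
open import Data.List.Relation.Unary.Any as Any using (Any; here; there)
open import Data.List.Relation.Unary.AllPairs using (AllPairs; []; _∷_)
open import Data.List.Relation.Unary.Unique.Propositional using (Unique)
import Data.List.Relation.Unary.Unique.Propositional.Properties as Unique
open import Data.List.Relation.Unary.Unique.DecPropositional _≟V_ using (unique?)
open import Data.List.Relation.Binary.Pointwise using (Pointwise; []; _∷_)
open import Data.List.Relation.Binary.Permutation.Propositional as ↭ using (_↭_; ↭-sym; ↭⇒↭ₛ)
open import Data.List.Relation.Binary.Permutation.Propositional.Properties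
  using (∈-resp-↭; filter-↭; ↭-length)
open import Relation.Binary.PropositionalEquality using (_≡_; _≢_; refl; sym; subst; setoid; resp₂)
open import Data.List.Relation.Binary.Permutation.Setoid.Properties (setoid (List V))
  using (AllPairs-resp-↭)
open import Data.List.Relation.Binary.BagAndSetEquality using (∼bag⇒↭)
open import Function.Bundles using (mk⇔)
open import Relation.Nullary using (¬_; Dec; yes; no; ¬?; does)
open import Relation.Nullary.Decidable using (map′; from-yes; _×-dec_; _⊎-dec_; _→-dec_)

pattern f₁ = zero
pattern f₂ = suc zero
pattern f₃ = suc (suc zero)

vertices : List V
vertices = v11 ∷ v12 ∷ v13 ∷ v21 ∷ v22 ∷ v23 ∷ v31 ∷ v32 ∷ v33 ∷ []

∈-vertices : ∀ v → v ∈ vertices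
∈-vertices (f₁ , f₁) = here refl
∈-vertices (f₁ , f₂) = there (here refl)
∈-vertices (f₁ , f₃) = there (there (here refl))
∈-vertices (f₂ , f₁) = there (there (there (here refl)))
∈-vertices (f₂ , f₂) = there (there (there (there (here refl))))
∈-vertices (f₂ , f₃) = there (there (there (there (there (here refl)))))
∈-vertices (f₃ , f₁) = there (there (there (there (there (there (here refl))))))
∈-vertices (f₃ , f₂) = there (there (there (there (there (there (there (here refl)))))))
∈-vertices (f₃ , f₃) = there (there (there (there (there (there (there (there (here refl))))))))

removed? : ∀ u v → Dec (Removed u v)
removed? u v = ((u ≟V v31 ×-dec v ≟V v32) ⊎-dec (u ≟V v32 ×-dec v ≟V v31))
          ⊎-dec ((u ≟V v32 ×-dec v ≟V v33) ⊎-dec (u ≟V v33 ×-dec v ≟V v32))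

adj₀? : ∀ u v → Dec (Adj₀ u v)
adj₀? u@(i , j) v@(p , q) = (∣ toℕ i - toℕ p ∣ + ∣ toℕ j - toℕ q ∣ ≟ℕ 1) ×-dec ¬? (removed? u v)

walk-start : ∀ {u v x p} → Walk u v (x ∷ p) → u ≡ x
walk-start single     = refl
walk-start (step _ _) = refl

start∈ : ∀ {u v p} → Walk u v p → u ∈ p
start∈ single     = here refl
start∈ (step _ _) = here refl

walk? : ∀ u v p → Dec (Walk u v p)
walk? u v []          = no λ ()
walk? u v (x ∷ [])    = map′ (λ { (refl , refl) → single })
                             (λ { single → refl , refl ; (step _ ()) })
                             (u ≟V x ×-dec v ≟V x)
walk? u v (x ∷ y ∷ q) = map′ (λ { (refl , a , w) → step a w }) unstep
                             (u ≟V x ×-dec adj₀? x y ×-dec walk? y v (y ∷ q))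
  where
  unstep : Walk u v (x ∷ y ∷ q) → u ≡ x × Adj₀ x y × Walk y v (y ∷ q)
  unstep (step a w) with refl ← walk-start w = refl , a , w

path? : ∀ u v p → Dec (Path u v p)
path? u v p = walk? u v p ×-dec unique? p

pathToA? : ∀ t p → Dec (PathToA t p)
pathToA? t p = map′ find (λ (a , a∈ , pa) → lose a∈ pa) (Any.any? (λ a → path? t a p) A)

edgeDisjoint? : ∀ p q → Dec (EdgeDisjoint p q)
edgeDisjoint? p q = map′ (λ h e f e∈ f∈ → All.lookup (All.lookup h e∈) f∈)
                         (λ h → All.tabulate λ e∈ → All.tabulate λ f∈ → h _ _ e∈ f∈)
                         (All.all? (λ e → All.all? (λ f → ¬? (sameEdge? e f)) (edges q)) (edges p))
  where
  _≟E_ = ≡-dec _≟V_ _≟V_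
  sameEdge? : ∀ e f → Dec (SameEdge e f)
  sameEdge? e f = (e ≟E f) ⊎-dec (e ≟E swap f)

remove : V → List V → List V
remove w = filter (λ x → ¬? (x ≟V w))

remove-shrinks : ∀ {w rem} → w ∈ rem → suc (length (remove w rem)) ≤ length rem
remove-shrinks {w} {rem} w∈ = filter-notAll (λ x → ¬? (x ≟V w)) rem (Any.map (λ eq ne → ne (sym eq)) w∈)

sequences : ℕ → V → List V → List (List V)
sequences zero    u rem = (u ∷ []) ∷ []
sequences (suc n) u rem = (u ∷ []) ∷ concatMap (λ w → map (u ∷_) (sequences n w (remove w rem)))
                                               (filter (adj₀? u) rem)

-- Completeness: a path from u whose other vertices lie in rem is enumerated,
-- provided the fuel is at least |rem| (each step removes a vertex from rem).
sequences-complete : ∀ n rem {u v p} → Walk u v p → Unique p →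
  (∀ x → x ∈ p → x ≢ u → x ∈ rem) → length rem ≤ n → p ∈ sequences n u rem
sequences-complete zero    rem single _ _ _ = here refl
sequences-complete (suc n) rem single _ _ _ = here refl
sequences-complete n rem {u} (step {w = w} {p = p} a walk) (u∉p ∷ unique) inRem fuel =
  through n (≤-trans (remove-shrinks w∈rem) fuel)
  where
  u≢ : ∀ {x} → x ∈ p → x ≢ u
  u≢ x∈p x≡u = All.lookup u∉p x∈p (sym x≡u)
  w∈rem : w ∈ rem
  w∈rem = inRem w (there (start∈ walk)) (u≢ (start∈ walk))
  inRem′ : ∀ x → x ∈ p → x ≢ w → x ∈ remove w rem
  inRem′ x x∈p = ∈-filter⁺ (λ y → ¬? (y ≟V w)) (inRem x (there x∈p) (u≢ x∈p))
  through : ∀ n → suc (length (remove w rem)) ≤ n → (u ∷ p) ∈ sequences n u rem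
  through (suc n) (s≤s fuel′) =
    there (∈-concatMap⁺ _ (Any.map (λ { refl → ∈-map⁺ (u ∷_) rest }) (∈-filter⁺ (adj₀? u) w∈rem a)))
    where
    rest : p ∈ sequences n w (remove w rem)
    rest = sequences-complete n (remove w rem) walk unique inRem′ fuel′

candidates : V → List (List V)
candidates u = sequences 9 u vertices

path∈candidates : ∀ {u v p} → Path u v p → p ∈ candidates u
path∈candidates (walk , unique) =
  sequences-complete 9 vertices walk unique (λ x _ _ → ∈-vertices x) ≤-refl

record PathTable (P : V → List V → Set) : Set where
  field
    paths    : V → List (List V)
    sound    : ∀ {u p} → p ∈ paths u → P u p
    complete : ∀ {u v p} → Path u v p → P u p → p ∈ paths u

Certificate : (P : V → List V → Set) → (∀ u p → Dec (P u p)) → (V → List (List V)) → Set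
Certificate P P? paths =
  All (λ u → All (P u) (paths u) × All (_∈ paths u) (filter (P? u) (candidates u))) vertices

certificate? : ∀ {P} (P? : ∀ u p → Dec (P u p)) paths → Dec (Certificate P P? paths)
certificate? P? paths =
  All.all? (λ u → All.all? (P? u) (paths u) ×-dec All.all? (_∈ₚ? paths u) (filter (P? u) (candidates u)))
           vertices
  where open Data.List.Membership.DecPropositional (≡-decᴸ _≟V_) renaming (_∈?_ to _∈ₚ?_)

certify : ∀ {P} (P? : ∀ u p → Dec (P u p)) paths → Certificate P P? paths → PathTable P
certify {P} P? paths cert = record { paths = paths ; sound = sound ; complete = complete }
  where
  entry : ∀ u → All (P u) (paths u) × All (_∈ paths u) (filter (P? u) (candidates u))
  entry u = All.lookup cert (∈-vertices u)
  sound : ∀ {u p} → p ∈ paths u → P u p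
  sound {u} = All.lookup (proj₁ (entry u))
  complete : ∀ {u v p} → Path u v p → P u p → p ∈ paths u
  complete {u} path Pp = All.lookup (proj₂ (entry u)) (∈-filter⁺ (P? u) (path∈candidates path) Pp)

routesToA : V → List (List V)
routesToA (f₁ , f₁) =
  (v11 ∷ v21 ∷ v31 ∷ []) ∷
  (v11 ∷ v12 ∷ v22 ∷ v32 ∷ []) ∷
  (v11 ∷ v21 ∷ v22 ∷ v32 ∷ []) ∷
  (v11 ∷ v12 ∷ v13 ∷ v23 ∷ v33 ∷ []) ∷
  (v11 ∷ v12 ∷ v22 ∷ v21 ∷ v31 ∷ []) ∷
  (v11 ∷ v12 ∷ v22 ∷ v23 ∷ v33 ∷ []) ∷
  (v11 ∷ v21 ∷ v22 ∷ v23 ∷ v33 ∷ []) ∷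
  (v11 ∷ v12 ∷ v13 ∷ v23 ∷ v22 ∷ v32 ∷ []) ∷
  (v11 ∷ v12 ∷ v13 ∷ v23 ∷ v22 ∷ v21 ∷ v31 ∷ []) ∷
  (v11 ∷ v21 ∷ v22 ∷ v12 ∷ v13 ∷ v23 ∷ v33 ∷ []) ∷
  []
routesToA (f₁ , f₂) =
  (v12 ∷ v22 ∷ v32 ∷ []) ∷
  (v12 ∷ v11 ∷ v21 ∷ v31 ∷ []) ∷
  (v12 ∷ v13 ∷ v23 ∷ v33 ∷ []) ∷
  (v12 ∷ v22 ∷ v21 ∷ v31 ∷ []) ∷
  (v12 ∷ v22 ∷ v23 ∷ v33 ∷ []) ∷
  (v12 ∷ v11 ∷ v21 ∷ v22 ∷ v32 ∷ []) ∷
  (v12 ∷ v13 ∷ v23 ∷ v22 ∷ v32 ∷ []) ∷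
  (v12 ∷ v11 ∷ v21 ∷ v22 ∷ v23 ∷ v33 ∷ []) ∷
  (v12 ∷ v13 ∷ v23 ∷ v22 ∷ v21 ∷ v31 ∷ []) ∷
  []
routesToA (f₁ , f₃) =
  (v13 ∷ v23 ∷ v33 ∷ []) ∷
  (v13 ∷ v12 ∷ v22 ∷ v32 ∷ []) ∷
  (v13 ∷ v23 ∷ v22 ∷ v32 ∷ []) ∷
  (v13 ∷ v12 ∷ v11 ∷ v21 ∷ v31 ∷ []) ∷
  (v13 ∷ v12 ∷ v22 ∷ v21 ∷ v31 ∷ []) ∷
  (v13 ∷ v12 ∷ v22 ∷ v23 ∷ v33 ∷ []) ∷
  (v13 ∷ v23 ∷ v22 ∷ v21 ∷ v31 ∷ []) ∷
  (v13 ∷ v12 ∷ v11 ∷ v21 ∷ v22 ∷ v32 ∷ []) ∷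
  (v13 ∷ v12 ∷ v11 ∷ v21 ∷ v22 ∷ v23 ∷ v33 ∷ []) ∷
  (v13 ∷ v23 ∷ v22 ∷ v12 ∷ v11 ∷ v21 ∷ v31 ∷ []) ∷
  []
routesToA (f₂ , f₁) =
  (v21 ∷ v31 ∷ []) ∷
  (v21 ∷ v22 ∷ v32 ∷ []) ∷
  (v21 ∷ v22 ∷ v23 ∷ v33 ∷ []) ∷
  (v21 ∷ v11 ∷ v12 ∷ v22 ∷ v32 ∷ []) ∷
  (v21 ∷ v11 ∷ v12 ∷ v13 ∷ v23 ∷ v33 ∷ []) ∷
  (v21 ∷ v11 ∷ v12 ∷ v22 ∷ v23 ∷ v33 ∷ []) ∷
  (v21 ∷ v22 ∷ v12 ∷ v13 ∷ v23 ∷ v33 ∷ []) ∷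
  (v21 ∷ v11 ∷ v12 ∷ v13 ∷ v23 ∷ v22 ∷ v32 ∷ []) ∷
  []
routesToA (f₂ , f₂) =
  (v22 ∷ v32 ∷ []) ∷
  (v22 ∷ v21 ∷ v31 ∷ []) ∷
  (v22 ∷ v23 ∷ v33 ∷ []) ∷
  (v22 ∷ v12 ∷ v11 ∷ v21 ∷ v31 ∷ []) ∷
  (v22 ∷ v12 ∷ v13 ∷ v23 ∷ v33 ∷ []) ∷
  (v22 ∷ v21 ∷ v11 ∷ v12 ∷ v13 ∷ v23 ∷ v33 ∷ []) ∷
  (v22 ∷ v23 ∷ v13 ∷ v12 ∷ v11 ∷ v21 ∷ v31 ∷ []) ∷
  []
routesToA (f₂ , f₃) =
  (v23 ∷ v33 ∷ []) ∷
  (v23 ∷ v22 ∷ v32 ∷ []) ∷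
  (v23 ∷ v22 ∷ v21 ∷ v31 ∷ []) ∷
  (v23 ∷ v13 ∷ v12 ∷ v22 ∷ v32 ∷ []) ∷
  (v23 ∷ v13 ∷ v12 ∷ v11 ∷ v21 ∷ v31 ∷ []) ∷
  (v23 ∷ v13 ∷ v12 ∷ v22 ∷ v21 ∷ v31 ∷ []) ∷
  (v23 ∷ v22 ∷ v12 ∷ v11 ∷ v21 ∷ v31 ∷ []) ∷
  (v23 ∷ v13 ∷ v12 ∷ v11 ∷ v21 ∷ v22 ∷ v32 ∷ []) ∷
  []
routesToA (f₃ , f₁) =
  (v31 ∷ []) ∷
  (v31 ∷ v21 ∷ v22 ∷ v32 ∷ []) ∷
  (v31 ∷ v21 ∷ v22 ∷ v23 ∷ v33 ∷ []) ∷
  (v31 ∷ v21 ∷ v11 ∷ v12 ∷ v22 ∷ v32 ∷ []) ∷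
  (v31 ∷ v21 ∷ v11 ∷ v12 ∷ v13 ∷ v23 ∷ v33 ∷ []) ∷
  (v31 ∷ v21 ∷ v11 ∷ v12 ∷ v22 ∷ v23 ∷ v33 ∷ []) ∷
  (v31 ∷ v21 ∷ v22 ∷ v12 ∷ v13 ∷ v23 ∷ v33 ∷ []) ∷
  (v31 ∷ v21 ∷ v11 ∷ v12 ∷ v13 ∷ v23 ∷ v22 ∷ v32 ∷ []) ∷
  []
routesToA (f₃ , f₂) =
  (v32 ∷ []) ∷
  (v32 ∷ v22 ∷ v21 ∷ v31 ∷ []) ∷
  (v32 ∷ v22 ∷ v23 ∷ v33 ∷ []) ∷
  (v32 ∷ v22 ∷ v12 ∷ v11 ∷ v21 ∷ v31 ∷ []) ∷
  (v32 ∷ v22 ∷ v12 ∷ v13 ∷ v23 ∷ v33 ∷ []) ∷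
  (v32 ∷ v22 ∷ v21 ∷ v11 ∷ v12 ∷ v13 ∷ v23 ∷ v33 ∷ []) ∷
  (v32 ∷ v22 ∷ v23 ∷ v13 ∷ v12 ∷ v11 ∷ v21 ∷ v31 ∷ []) ∷
  []
routesToA (f₃ , f₃) =
  (v33 ∷ []) ∷
  (v33 ∷ v23 ∷ v22 ∷ v32 ∷ []) ∷
  (v33 ∷ v23 ∷ v22 ∷ v21 ∷ v31 ∷ []) ∷
  (v33 ∷ v23 ∷ v13 ∷ v12 ∷ v22 ∷ v32 ∷ []) ∷
  (v33 ∷ v23 ∷ v13 ∷ v12 ∷ v11 ∷ v21 ∷ v31 ∷ []) ∷
  (v33 ∷ v23 ∷ v13 ∷ v12 ∷ v22 ∷ v21 ∷ v31 ∷ []) ∷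
  (v33 ∷ v23 ∷ v22 ∷ v12 ∷ v11 ∷ v21 ∷ v31 ∷ []) ∷
  (v33 ∷ v23 ∷ v13 ∷ v12 ∷ v11 ∷ v21 ∷ v22 ∷ v32 ∷ []) ∷
  []

pathsToB : V → List (List V)
pathsToB (f₁ , f₁) =
  (v11 ∷ v12 ∷ v13 ∷ v23 ∷ []) ∷
  (v11 ∷ v12 ∷ v22 ∷ v23 ∷ []) ∷
  (v11 ∷ v21 ∷ v22 ∷ v23 ∷ []) ∷
  (v11 ∷ v21 ∷ v22 ∷ v12 ∷ v13 ∷ v23 ∷ []) ∷
  []
pathsToB (f₁ , f₂) =
  (v12 ∷ v13 ∷ v23 ∷ []) ∷
  (v12 ∷ v22 ∷ v23 ∷ []) ∷
  (v12 ∷ v11 ∷ v21 ∷ v22 ∷ v23 ∷ []) ∷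
  []
pathsToB (f₁ , f₃) =
  (v13 ∷ v23 ∷ []) ∷
  (v13 ∷ v12 ∷ v22 ∷ v23 ∷ []) ∷
  (v13 ∷ v12 ∷ v11 ∷ v21 ∷ v22 ∷ v23 ∷ []) ∷
  []
pathsToB (f₂ , f₁) =
  (v21 ∷ v22 ∷ v23 ∷ []) ∷
  (v21 ∷ v11 ∷ v12 ∷ v13 ∷ v23 ∷ []) ∷
  (v21 ∷ v11 ∷ v12 ∷ v22 ∷ v23 ∷ []) ∷
  (v21 ∷ v22 ∷ v12 ∷ v13 ∷ v23 ∷ []) ∷
  []
pathsToB (f₂ , f₂) =
  (v22 ∷ v23 ∷ []) ∷
  (v22 ∷ v12 ∷ v13 ∷ v23 ∷ []) ∷
  (v22 ∷ v21 ∷ v11 ∷ v12 ∷ v13 ∷ v23 ∷ []) ∷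
  []
pathsToB (f₂ , f₃) =
  (v23 ∷ []) ∷
  []
pathsToB (f₃ , f₁) =
  (v31 ∷ v21 ∷ v22 ∷ v23 ∷ []) ∷
  (v31 ∷ v21 ∷ v11 ∷ v12 ∷ v13 ∷ v23 ∷ []) ∷
  (v31 ∷ v21 ∷ v11 ∷ v12 ∷ v22 ∷ v23 ∷ []) ∷
  (v31 ∷ v21 ∷ v22 ∷ v12 ∷ v13 ∷ v23 ∷ []) ∷
  []
pathsToB (f₃ , f₂) =
  (v32 ∷ v22 ∷ v23 ∷ []) ∷
  (v32 ∷ v22 ∷ v12 ∷ v13 ∷ v23 ∷ []) ∷
  (v32 ∷ v22 ∷ v21 ∷ v11 ∷ v12 ∷ v13 ∷ v23 ∷ []) ∷
  []
pathsToB (f₃ , f₃) =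
  (v33 ∷ v23 ∷ []) ∷
  []

routesTable : PathTable PathToA
routesTable = certify pathToA? routesToA (from-yes (certificate? pathToA? routesToA))

bPathTable : PathTable (λ u p → Path u b p)
bPathTable = certify (λ u → path? u b) pathsToB (from-yes (certificate? (λ u → path? u b) pathsToB))

Routing : List (List V) → List V → Set
Routing placed ts = ∃[ Ps ] (Pointwise PathToA ts Ps × AllPairs EdgeDisjoint Ps
                             × All (λ q → All (EdgeDisjoint q) Ps) placed)

routing? : ∀ placed ts → Dec (Routing placed ts)
routing? placed []       = yes ([] , [] , [] , All.tabulate λ _ → [])
routing? placed (t ∷ ts) = map′ extend restrict
  (Any.any? (λ p → All.all? (λ q → edgeDisjoint? q p) placed ×-dec routing? (p ∷ placed) ts) (paths t))
  where
  open PathTable routesTable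
  Choice : List V → Set
  Choice p = All (λ q → EdgeDisjoint q p) placed × Routing (p ∷ placed) ts
  extend : Any Choice (paths t) → Routing placed (t ∷ ts)
  extend choice with p , p∈ , avoid , (Ps , toA , disjoint , p-avoids ∷ placed-avoid) ← find choice =
    p ∷ Ps , sound p∈ ∷ toA , p-avoids ∷ disjoint , All.zipWith (λ (h , hs) → h ∷ hs) (avoid , placed-avoid)
  restrict : Routing placed (t ∷ ts) → Any Choice (paths t)
  restrict (p ∷ Ps , toA@(_ , _ , path) ∷ toAs , p-avoids ∷ disjoint , placed-avoid) =
    lose (complete path toA)
      (All.map All.head placed-avoid , Ps , toAs , disjoint , p-avoids ∷ All.map All.tail placed-avoid)

good? : ∀ T s → Dec (Good T s)
good? T s = map′ fromChoice toChoice
  ((s ∈? T) ×-dec Any.any? (λ P → routing? (P ∷ []) (T minus s)) (paths s))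
  where
  open PathTable bPathTable
  fromChoice : s ∈ T × Any (λ P → Routing (P ∷ []) (T minus s)) (paths s) → Good T s
  fromChoice (s∈T , choice) with P , P∈ , (Ps , toA , disjoint , P-avoids ∷ []) ← find choice =
    s∈T , P , sound P∈ , Ps , toA , P-avoids ∷ disjoint
  toChoice : Good T s → s ∈ T × Any (λ P → Routing (P ∷ []) (T minus s)) (paths s)
  toChoice (s∈T , P , path , Ps , toA , P-avoids ∷ disjoint) =
    s∈T , lose (complete path path) (Ps , toA , disjoint , P-avoids ∷ [])

pointwise-↭ : ∀ {a b r} {X : Set a} {Y : Set b} {R : X → Y → Set r} {xs xs′ ys} →
  Pointwise R xs ys → xs ↭ xs′ → ∃[ ys′ ] (Pointwise R xs′ ys′ × ys ↭ ys′)
pointwise-↭ rs ↭.refl = _ , rs , ↭.refl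
pointwise-↭ (r ∷ rs) (↭.prep _ σ) with _ , rs′ , τ ← pointwise-↭ rs σ = _ , r ∷ rs′ , ↭.prep _ τ
pointwise-↭ (r ∷ r′ ∷ rs) (↭.swap _ _ σ) with _ , rs′ , τ ← pointwise-↭ rs σ =
  _ , r′ ∷ r ∷ rs′ , ↭.swap _ _ τ
pointwise-↭ rs (↭.trans σ σ′) with _ , rs′ , τ ← pointwise-↭ rs σ with _ , rs″ , τ′ ← pointwise-↭ rs′ σ′ =
  _ , rs″ , ↭.trans τ τ′

edgeDisjoint-sym : ∀ {p q} → EdgeDisjoint p q → EdgeDisjoint q p
edgeDisjoint-sym h e f e∈ f∈ (inj₁ refl) = h f f f∈ e∈ (inj₁ refl)
edgeDisjoint-sym h e f e∈ f∈ (inj₂ refl) = h f (swap f) f∈ e∈ (inj₂ refl)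

-- Goodness depends on T only up to reordering: permute the routes to A along with T ∖ {s}.
good-↭ : ∀ {T T′ s} → T ↭ T′ → Good T s → Good T′ s
good-↭ {s = s} σ (s∈T , P , path , Ps , toA , disjoint)
  with Ps′ , toA′ , τ ← pointwise-↭ toA (filter-↭ (λ t → ¬? (t ≟V s)) σ) =
  ∈-resp-↭ σ s∈T , P , path , Ps′ , toA′ ,
  AllPairs-resp-↭ edgeDisjoint-sym (resp₂ EdgeDisjoint) (↭⇒↭ₛ (↭.prep P τ)) disjoint

Claims : List V → Set
Claims T = (((∀ a → a ∈ A → a ∉ T) → c ∉ T → ∀ s → s ∈ T → Good T s)
    × ((¬ SameSet T T₁ → ¬ SameSet T T₂ → AtLeastGood (3 ⊓ length T) T)
    × ((SameSet T T₁ → ∀ s → (Good T s → s ≡ v11 ⊎ s ≡ v21) × (s ≡ v11 ⊎ s ≡ v21 → Good T s))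
    × (SameSet T T₂ → ∀ s → (Good T s → s ≡ v23 ⊎ s ≡ v13) × (s ≡ v23 ⊎ s ≡ v13 → Good T s)))))

sameSet-↭ : ∀ {T S R} → T ↭ S → SameSet T R → SameSet S R
sameSet-↭ σ same v = (λ v∈S → proj₁ (same v) (∈-resp-↭ (↭-sym σ) v∈S))
                   , (λ v∈R → ∈-resp-↭ σ (proj₂ (same v) v∈R))

claims-↭ : ∀ {T S} → T ↭ S → Claims S → Claims T
claims-↭ {T} {S} σ (claim₁ , claim₂ , claim₃ , claim₄) =
  (λ noA noC s s∈T → good-↭ σ⁻ (claim₁ (λ a a∈A a∈S → noA a a∈A (∈-resp-↭ σ⁻ a∈S))
                                        (λ c∈S → noC (∈-resp-↭ σ⁻ c∈S)) s (∈-resp-↭ σ s∈T))) ,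
  (λ not₁ not₂ → atLeast (claim₂ (λ same → not₁ (sameSet-↭ σ⁻ same)) (λ same → not₂ (sameSet-↭ σ⁻ same)))) ,
  (λ same s → exactly (claim₃ (sameSet-↭ σ same) s)) ,
  (λ same s → exactly (claim₄ (sameSet-↭ σ same) s))
  where
  σ⁻ : S ↭ T
  σ⁻ = ↭-sym σ
  atLeast : AtLeastGood (3 ⊓ length S) S → AtLeastGood (3 ⊓ length T) T
  atLeast (G , uniqueG , G⊆S , goodG , bound) =
    G , uniqueG , (λ v v∈G → ∈-resp-↭ σ⁻ (G⊆S v v∈G)) , (λ v v∈G → good-↭ σ⁻ (goodG v v∈G)) ,
    subst (λ n → 3 ⊓ n ≤ length G) (sym (↭-length σ)) bound
  exactly : ∀ {s X} → (Good S s → X) × (X → Good S s) → (Good T s → X) × (X → Good T s)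
  exactly (only , all) = (λ g → only (good-↭ σ g)) , (λ x → good-↭ σ⁻ (all x))

SameSet′ : List V → List V → Set
SameSet′ S T = All (_∈ T) S × All (_∈ S) T

sameSet′? : ∀ S T → Dec (SameSet′ S T)
sameSet′? S T = All.all? (_∈? T) S ×-dec All.all? (_∈? S) T

sameSet⇒sameSet′ : ∀ {S T} → SameSet S T → SameSet′ S T
sameSet⇒sameSet′ same = All.tabulate (λ {v} → proj₁ (same v)) , All.tabulate (λ {v} → proj₂ (same v))

-- The claims for S with every quantifier bounded by a finite list, so that they can be
-- decided; the good vertices of S are collected by filtering S with good?.
CheckedClaims : List V → Set
CheckedClaims S =
  (All (_∉ S) A → c ∉ S → All (Good S) S)
  × (¬ SameSet′ S T₁ → ¬ SameSet′ S T₂ → 3 ⊓ length S ≤ length (filter (good? S) S))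
  × (SameSet′ S T₁ → All (λ s → (Good S s → s ≡ v11 ⊎ s ≡ v21) × (s ≡ v11 ⊎ s ≡ v21 → Good S s)) vertices)
  × (SameSet′ S T₂ → All (λ s → (Good S s → s ≡ v23 ⊎ s ≡ v13) × (s ≡ v23 ⊎ s ≡ v13 → Good S s)) vertices)

checkedClaims? : ∀ S → Dec (CheckedClaims S)
checkedClaims? S =
  (All.all? (λ a → ¬? (a ∈? S)) A →-dec ¬? (c ∈? S) →-dec All.all? (good? S) S)
  ×-dec (¬? (sameSet′? S T₁) →-dec ¬? (sameSet′? S T₂) →-dec (3 ⊓ length S ≤? length (filter (good? S) S)))
  ×-dec (sameSet′? S T₁ →-dec All.all? (λ s → (good? S s →-dec (s ≟V v11 ⊎-dec s ≟V v21))
                                               ×-dec ((s ≟V v11 ⊎-dec s ≟V v21) →-dec good? S s)) vertices)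
  ×-dec (sameSet′? S T₂ →-dec All.all? (λ s → (good? S s →-dec (s ≟V v23 ⊎-dec s ≟V v13))
                                               ×-dec ((s ≟V v23 ⊎-dec s ≟V v13) →-dec good? S s)) vertices)

checked⇒claims : ∀ {S} → Unique S → CheckedClaims S → Claims S
checked⇒claims {S} uniqueS (check₁ , check₂ , check₃ , check₄) =
  (λ noA noC s s∈S → All.lookup (check₁ (All.tabulate (λ {a} → noA a)) noC) s∈S) ,
  (λ not₁ not₂ → filter (good? S) S , Unique.filter⁺ (good? S) uniqueS ,
     (λ v v∈ → proj₁ (∈-filter⁻ (good? S) {xs = S} v∈)) ,
     (λ v v∈ → proj₂ (∈-filter⁻ (good? S) {xs = S} v∈)) ,
     check₂ (λ same → not₁ (unfold same)) (λ same → not₂ (unfold same))) ,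
  (λ same s → All.lookup (check₃ (sameSet⇒sameSet′ same)) (∈-vertices s)) ,
  (λ same s → All.lookup (check₄ (sameSet⇒sameSet′ same)) (∈-vertices s))
  where
  unfold : ∀ {T} → SameSet′ S T → SameSet S T
  unfold (S⊆T , T⊆S) v = All.lookup S⊆T , All.lookup T⊆S

sublists : List V → List (List V)
sublists []       = [] ∷ []
sublists (x ∷ xs) = map (x ∷_) (sublists xs) ++ sublists xs

filter∈sublists : ∀ {P : V → Set} (P? : ∀ x → Dec (P x)) xs → filter P? xs ∈ sublists xs
filter∈sublists P? []       = here refl
filter∈sublists P? (x ∷ xs) with does (P? x)
... | true  = ∈-++⁺ˡ (∈-map⁺ (x ∷_) (filter∈sublists P? xs))
... | false = ∈-++⁺ʳ (map (x ∷_) (sublists xs)) (filter∈sublists P? xs)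

all-subsets-checked : All (λ S → length S ≤ 4 → CheckedClaims S) (sublists vertices)
all-subsets-checked = from-yes (All.all? (λ S → (length S ≤? 4) →-dec checkedClaims? S) (sublists vertices))

canonical : List V → List V
canonical T = filter (_∈? T) vertices

canonical-unique : ∀ T → Unique (canonical T)
canonical-unique T = Unique.filter⁺ (_∈? T) (from-yes (unique? vertices))

canonical-↭ : ∀ {T} → Unique T → T ↭ canonical T
canonical-↭ {T} uniqueT = ∼bag⇒↭ (unique∧set⇒bag uniqueT (canonical-unique T) (mk⇔ to from))
  where
  to : ∀ {x} → x ∈ T → x ∈ canonical T
  to {x} x∈T = ∈-filter⁺ (_∈? T) (∈-vertices x) x∈T
  from : ∀ {x} → x ∈ canonical T → x ∈ T
  from x∈ = proj₂ (∈-filter⁻ (_∈? T) {xs = vertices} x∈)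

lemma9 : (T : List V) → Unique T → length T ≤ 4 →
    (((∀ a → a ∈ A → a ∉ T) → c ∉ T → ∀ s → s ∈ T → Good T s)
    × ((¬ SameSet T T₁ → ¬ SameSet T T₂ → AtLeastGood (3 ⊓ length T) T)
    × ((SameSet T T₁ → ∀ s → (Good T s → s ≡ v11 ⊎ s ≡ v21) × (s ≡ v11 ⊎ s ≡ v21 → Good T s))
    × (SameSet T T₂ → ∀ s → (Good T s → s ≡ v23 ⊎ s ≡ v13) × (s ≡ v23 ⊎ s ≡ v13 → Good T s)))))
lemma9 T uniqueT size = claims-↭ σ (checked⇒claims (canonical-unique T) checked)
  where
  σ : T ↭ canonical T
  σ = canonical-↭ uniqueT
  checked : CheckedClaims (canonical T)
  checked = All.lookup all-subsets-checked (filter∈sublists (_∈? T) vertices)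
                       (subst (_≤ 4) (↭-length σ) size)
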